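{- For every finite digraph $G=(V,E)$ with $n=|V|$ nodes and every threshold function $t:V\to\mathbb{N}$, in every execution of the algorithm MTS on input $(G,t)$ each iteration of the while loop selects a node of $U$, and the number of iterations of the while loop is at most $2n$.
   Context: Digraphs are finite, without loops. For a digraph $G=(V,E)$ and $v\in V$, $\Gamma^{in}(v)=\{u:(u,v)\in E\}$ and $\Gamma^{out}(v)=\{u:(v,u)\in E\}$; thresholds are a function $t:V\to\mathbb{N}=\{0,1,2,\dots\}$. Algorithm MTS on input $(G,t)$: set $S=\emptyset$, $L=\emptyset$, $U=V$, and for each $v\in V$ set $k(v)=t(v)$, $\delta(v)=|\Gamma^{in}(v)|$. While $U\neq\emptyset$, perform one iteration as follows. Case 1: if some $v\in U$ has $k(v)=0$, select such a $v$; for each $u\in\Gamma^{out}(v)\cap U$ set $k(u)=\max(k(u)-1,0)$ and, if $v\notin L$, set $\delta(u)=\delta(u)-1$; then set $U=U\setminus\{v\}$. Case 2: otherwise, if some $v\in U\setminus L$ has $\delta(v)<k(v)$, select such a $v$; set $S=S\cup\{v\}$; for each $u\in\Gamma^{out}(v)\cap U$ set $k(u)=k(u)-1$ and $\delta(u)=\delta(u)-1$; then set $U=U\setminus\{v\}$. Case 3: otherwise, select $v\in U\setminus L$ maximizing $\frac{k(u)}{\delta(u)(\delta(u)+1)}$ over $u\in U\setminus L$; for each $u\in\Gamma^{out}(v)\cap U$ set $\delta(u)=\delta(u)-1$; set $L=L\cup\{v\}$. When $U=\emptyset$, return $S$. Whenever several nodes qualify in a case, one of them is chosen arbitrarily.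 -}

module Defs where

open import Data.Nat as ℕ using (ℕ; zero; suc; _∸_)
open import Data.Integer as ℤ using (ℤ; +_; _-_; _*_; _+_; _≤_; _<_)
open import Data.Fin using (Fin; _≟_)
open import Data.Bool using (Bool; true; false; if_then_else_; _∧_; not)
open import Data.List using (List; map; allFin)
open import Data.Nat.ListAction using (sum)
open import Data.Product using (∃)
open import Relation.Nullary using (¬_)
open import Relation.Nullary.Decidable using (⌊_⌋)
open import Relation.Binary.PropositionalEquality using (_≡_)

-- A digraph on the node set V = Fin n is given by its adjacency relation
-- E u v = true  iff  (u , v) is an edge.  (Loop-freeness is a hypothesis.)
Digraph : ℕ → Set
Digraph n = Fin n → Fin n → Bool

indeg : ∀ {n} → Digraph n → Fin n → ℕ
indeg {n} E v = sum (map (λ u → if E u v then 1 else 0) (allFin n))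

Subset′ : ℕ → Set
Subset′ n = Fin n → Bool

update : ∀ {n} {A : Set} → (Fin n → A) → Fin n → A → (Fin n → A)
update f v a u = if ⌊ u ≟ v ⌋ then a else f u

-- State of algorithm MTS: the sets S, L, U and the variables k(v), δ(v).
-- k stays a natural number (its decrements are truncated in Case 1 and
-- only applied to values ≥ 1 in Case 2); δ is kept as an integer so that
-- the subtraction δ(u) - 1 is the literal one.
record State (n : ℕ) : Set where
  constructor st
  field
    S U L : Subset′ n
    k     : Fin n → ℕ
    δ     : Fin n → ℤ
open State public

initState : ∀ {n} → Digraph n → (Fin n → ℕ) → State n
initState E t = st (λ _ → false) (λ _ → true) (λ _ → false) t (λ v → + indeg E v)

data Step {n : ℕ} (E : Digraph n) (s : State n) : State n → Set where
  case1 : (v : Fin n) → U s v ≡ true → k s v ≡ 0 →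
    Step E s (st (S s)
                 (update (U s) v false)
                 (L s)
                 (λ u → if E v u ∧ U s u then k s u ∸ 1 else k s u)
                 (λ u → if E v u ∧ U s u ∧ not (L s v) then δ s u - + 1 else δ s u))
  case2 : (∀ u → U s u ≡ true → ¬ (k s u ≡ 0)) →
    (v : Fin n) → U s v ≡ true → L s v ≡ false → δ s v < + k s v →
    Step E s (st (update (S s) v true)
                 (update (U s) v false)
                 (L s)
                 (λ u → if E v u ∧ U s u then k s u ∸ 1 else k s u)
                 (λ u → if E v u ∧ U s u then δ s u - + 1 else δ s u))
  -- maximality of k(u)/(δ(u)(δ(u)+1)) is expressed by cross-multiplication;
  -- all denominators are ≥ 2 here since Cases 1 and 2 do not apply
  -- (k(u) ≥ 1 and δ(u) ≥ k(u) for u ∈ U \ L).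
  case3 : (∀ u → U s u ≡ true → ¬ (k s u ≡ 0)) →
    (∀ u → U s u ≡ true → L s u ≡ false → ¬ (δ s u < + k s u)) →
    (v : Fin n) → U s v ≡ true → L s v ≡ false →
    (∀ u → U s u ≡ true → L s u ≡ false →
       + k s u * (δ s v * (δ s v + + 1)) ≤ + k s v * (δ s u * (δ s u + + 1))) →
    Step E s (st (S s)
                 (U s)
                 (update (L s) v true)
                 (k s)
                 (λ u → if E v u ∧ U s u then δ s u - + 1 else δ s u))

data Run {n : ℕ} (E : Digraph n) : ℕ → State n → State n → Set where
  done : ∀ {s} → Run E 0 s s
  next : ∀ {m s s′ s″} → Step E s s′ → Run E m s′ s″ → Run E (suc m) s s″

-- Two invariants drive the argument. For u ∈ U, δ(u) is the number of in-neighbours of u in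
-- U \ L. For u ∈ U ∩ L, k(u) is at most the number of in-neighbours w ∈ U that are not in L or
-- entered L after u: when u enters L we have k(u) ≤ δ(u) (Case 2 does not apply), and later
-- every in-neighbour leaving U lowers k(u) by one. Hence if U ⊆ L, the node of U that entered
-- L last has k = 0 and Case 1 applies; if U \ L ≠ ∅, then Case 1, 2 or 3 applies, where in
-- Case 3 all denominators δ(δ+1) are positive, so the maximum exists. The iteration bound
-- holds because every iteration decreases |U| + |V \ L|, which is initially 2n.
module Submission where

open import Defs
open import Data.Nat using (ℕ; _≤_; _*_)
open import Data.Fin using (Fin)
open import Data.Bool using (Bool; true; false)
open import Data.Product using (_×_; ∃)
open import Relation.Binary.PropositionalEquality using (_≡_)

open import Algebra.Properties.CommutativeSemigroup using (x∙yz≈y∙xz; xy∙z≈xz∙y)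
open import Data.Bool using (not; _∧_; _∨_; if_then_else_)
import Data.Bool.Properties as Bool
open import Data.Empty using (⊥-elim)
open import Data.Fin using (zero; suc; _≟_)
import Data.Fin.Properties as Fin
open import Data.Integer as ℤ using (ℤ; +_; +[1+_]; 1ℤ; +≤+; Positive; NonNegative)
import Data.Integer.Properties as ℤ
open import Data.List using (map; allFin; tabulate)
import Data.List.Properties as List
open import Data.Nat using (zero; suc; _+_; _∸_; _<_; _<?_; z≤n; s≤s)
import Data.Nat.Properties as ℕ
open import Data.Nat.ListAction using (sum)
open import Data.Product using (_,_; -,_)
open import Data.Sum using (_⊎_; inj₁; inj₂; reduce)
open import Function using (id; _∘_)
open import Relation.Binary using (Rel)
open import Relation.Binary.PropositionalEquality
  using (refl; sym; trans; cong; cong₂; subst; subst₂; _≢_; module ≡-Reasoning)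
open import Relation.Nullary using (¬_; Dec; yes; no; does; _×-dec_)
open import Relation.Nullary.Decidable using (dec-true; dec-false)
open import Relation.Unary using (Pred; Decidable)

toℕ : Bool → ℕ
toℕ false = 0
toℕ true  = 1

toℕ≤1 : ∀ b → toℕ b ≤ 1
toℕ≤1 false = z≤n
toℕ≤1 true  = ℕ.≤-refl

toℕ-mono : ∀ {a b} → (a ≡ true → b ≡ true) → toℕ a ≤ toℕ b
toℕ-mono {false} _   = z≤n
toℕ-mono {true}  a⇒b rewrite a⇒b refl = ℕ.≤-refl

toℕ-∧-monoʳ : ∀ a {b c} → toℕ b ≤ toℕ c → toℕ (a ∧ b) ≤ toℕ (a ∧ c)
toℕ-∧-monoʳ false _   = z≤n
toℕ-∧-monoʳ true  b≤c = b≤c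

∧-∧-monoʳ : ∀ e x {a b} → (e ≡ true → a ≡ true → b ≡ true) → e ∧ x ∧ a ≡ true → e ∧ x ∧ b ≡ true
∧-∧-monoʳ true true a⇒b a = a⇒b refl a

count : ∀ {n} → (Fin n → Bool) → ℕ
count {zero}  f = 0
count {suc n} f = toℕ (f zero) + count (f ∘ suc)

count-cong : ∀ {n} {f g : Fin n → Bool} → (∀ w → f w ≡ g w) → count f ≡ count g
count-cong {zero}  f≡g = refl
count-cong {suc n} f≡g = cong₂ _+_ (cong toℕ (f≡g zero)) (count-cong (f≡g ∘ suc))

count-mono : ∀ {n} {f g : Fin n → Bool} → (∀ w → f w ≡ true → g w ≡ true) → count f ≤ count g
count-mono {zero}  f⇒g = z≤n
count-mono {suc n} f⇒g = ℕ.+-mono-≤ (toℕ-mono (f⇒g zero)) (count-mono (f⇒g ∘ suc))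

count-true : ∀ n → count {n} (λ _ → true) ≡ n
count-true zero    = refl
count-true (suc n) = cong suc (count-true n)

count-false : ∀ {n} {f : Fin n → Bool} → (∀ w → f w ≡ false) → count f ≡ 0
count-false {zero}  f≡false = refl
count-false {suc n} f≡false rewrite f≡false zero = count-false (f≡false ∘ suc)

count-except : ∀ {n} {f g : Fin n → Bool} v → (∀ w → w ≢ v → f w ≡ g w) → g v ≡ false →
               count f ≡ toℕ (f v) + count g
count-except {suc n} {f} {g} zero f≈g gv≡false rewrite gv≡false =
  cong (λ m → toℕ (f zero) + m) (count-cong λ w → f≈g (suc w) λ ())
count-except {suc n} {f} {g} (suc v) f≈g gv≡false = begin
  toℕ (f zero) + count (f ∘ suc)
    ≡⟨ cong (λ m → toℕ (f zero) + m)
            (count-except v (λ w w≢v → f≈g (suc w) (w≢v ∘ Fin.suc-injective)) gv≡false) ⟩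
  toℕ (f zero) + (toℕ (f (suc v)) + count (g ∘ suc))
    ≡⟨ x∙yz≈y∙xz ℕ.+-commutativeSemigroup (toℕ (f zero)) (toℕ (f (suc v))) (count (g ∘ suc)) ⟩
  toℕ (f (suc v)) + (toℕ (f zero) + count (g ∘ suc))
    ≡⟨ cong (λ b → toℕ (f (suc v)) + (toℕ b + count (g ∘ suc))) (f≈g zero λ ()) ⟩
  toℕ (f (suc v)) + count g ∎
  where open ≡-Reasoning

count≡sum : ∀ {n} (f : Fin n → Bool) → count f ≡ sum (map (λ w → if f w then 1 else 0) (allFin n))
count≡sum {zero}  f = refl
count≡sum {suc n} f = cong₂ _+_ (toℕ≡if (f zero)) (begin
  count (f ∘ suc)                         ≡⟨ count≡sum (f ∘ suc) ⟩
  sum (map (indicator ∘ suc) (allFin n))  ≡⟨ cong sum (List.map-tabulate id (indicator ∘ suc)) ⟩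
  sum (tabulate (indicator ∘ suc))        ≡⟨ cong sum (List.map-tabulate suc indicator) ⟨
  sum (map indicator (tabulate suc))      ∎)
  where
  open ≡-Reasoning
  indicator : Fin (suc n) → ℕ
  indicator w = if f w then 1 else 0
  toℕ≡if : ∀ b → toℕ b ≡ (if b then 1 else 0)
  toℕ≡if false = refl
  toℕ≡if true  = refl

update-≡ : ∀ {n} {A : Set} (f : Fin n → A) v a → update f v a v ≡ a
update-≡ f v a with v ≟ v
... | yes _   = refl
... | no v≢v = ⊥-elim (v≢v refl)

update-≢ : ∀ {n} {A : Set} (f : Fin n → A) {v} a {w} → w ≢ v → update f v a w ≡ f w
update-≢ f {v} a {w} w≢v with w ≟ v
... | yes w≡v = ⊥-elim (w≢v w≡v)
... | no _    = refl

update-false⇒≢ : ∀ {n} (X : Fin n → Bool) {v w} → update X v false w ≡ true → w ≢ v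
update-false⇒≢ X {v} Xw refl with () ← trans (sym (update-≡ X v false)) Xw

update-false⇒true : ∀ {n} (X : Fin n → Bool) {v w} → update X v false w ≡ true → X w ≡ true
update-false⇒true X Xw = trans (sym (update-≢ X false (update-false⇒≢ X Xw))) Xw

count-update : ∀ {n} (X : Fin n → Bool) v b (F : Fin n → Bool → Bool) → F v b ≡ false →
               count (λ w → F w (X w)) ≡ toℕ (F v (X v)) + count (λ w → F w (update X v b w))
count-update X v b F Fvb≡false =
  count-except v (λ w w≢v → cong (F w) (sym (update-≢ X b w≢v)))
                 (trans (cong (F v) (update-≡ X v b)) Fvb≡false)

count-removed : ∀ {n} (X : Fin n → Bool) {v} → X v ≡ true → count X ≡ suc (count (update X v false))
count-removed X {v} Xv =
  trans (count-update X v false (λ _ x → x) refl) (cong (λ b → toℕ b + count (update X v false)) Xv)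

count-not-marked : ∀ {n} (Y : Fin n → Bool) {v} → Y v ≡ false →
                   count (not ∘ Y) ≡ suc (count (not ∘ update Y v true))
count-not-marked Y {v} Yv =
  trans (count-update Y v true (λ _ y → not y) refl)
        (cong (λ b → toℕ (not b) + count (not ∘ update Y v true)) Yv)

count-∧-removed : ∀ {n} (X : Fin n → Bool) {v} (ψ φ : Fin n → Bool) → X v ≡ true →
                  count (λ w → ψ w ∧ X w ∧ φ w) ≡
                  toℕ (ψ v ∧ φ v) + count (λ w → ψ w ∧ update X v false w ∧ φ w)
count-∧-removed X {v} ψ φ Xv =
  trans (count-update X v false (λ w x → ψ w ∧ x ∧ φ w) (Bool.∧-zeroʳ (ψ v)))
        (cong (λ x → toℕ (ψ v ∧ x ∧ φ v) + count (λ w → ψ w ∧ update X v false w ∧ φ w)) Xv)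

∃-greatest : ∀ {n p r} {P : Pred (Fin n) p} (R : Rel (Fin n) r) → Decidable P →
             (∀ {x y} → P x → P y → R x y ⊎ R y x) →
             (∀ {x y z} → P x → P y → P z → R x y → R y z → R x z) →
             ∃ P → ∃ λ m → P m × (∀ {x} → P x → R x m)
∃-greatest {zero} R P? total transitive (() , _)
∃-greatest {suc n} {P = P} R P? total transitive (x , Px) with Fin.any? (P? ∘ suc)
... | no ¬P∘suc = zero , P0 x Px , greatest
  where
  P0 : ∀ x → P x → P zero
  P0 zero    Px = Px
  P0 (suc x) Px = ⊥-elim (¬P∘suc (x , Px))
  greatest : ∀ {x} → P x → R x zero
  greatest {zero}  P0 = reduce (total P0 P0)
  greatest {suc x} Px = ⊥-elim (¬P∘suc (x , Px))
... | yes ∃P∘suc with ∃-greatest (λ x y → R (suc x) (suc y)) (P? ∘ suc) total transitive ∃P∘suc | P? zero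
...   | m , Pm , greatest | no ¬P0 = suc m , Pm , λ { {zero} P0 → ⊥-elim (¬P0 P0) ; {suc x} → greatest }
...   | m , Pm , greatest | yes P0 with total P0 Pm
...     | inj₁ R0m = suc m , Pm , λ { {zero} _ → R0m ; {suc x} → greatest }
...     | inj₂ Rm0 = zero , P0 , λ { {zero} _ → reduce (total P0 P0)
                                 ; {suc x} Px → transitive Px Pm P0 (greatest Px) Rm0 }

*-cross-≤-trans : ∀ {a b c A B C : ℤ} .{{_ : NonNegative A}} .{{_ : Positive B}} .{{_ : NonNegative C}} →
                  a ℤ.* B ℤ.≤ b ℤ.* A → b ℤ.* C ℤ.≤ c ℤ.* B → a ℤ.* C ℤ.≤ c ℤ.* A
*-cross-≤-trans {a} {b} {c} {A} {B} {C} aB≤bA bC≤cB = ℤ.*-cancelʳ-≤-pos (a ℤ.* C) (c ℤ.* A) B (begin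
  a ℤ.* C ℤ.* B  ≡⟨ swap a C B ⟩
  a ℤ.* B ℤ.* C  ≤⟨ ℤ.*-monoʳ-≤-nonNeg C aB≤bA ⟩
  b ℤ.* A ℤ.* C  ≡⟨ swap b A C ⟩
  b ℤ.* C ℤ.* A  ≤⟨ ℤ.*-monoʳ-≤-nonNeg A bC≤cB ⟩
  c ℤ.* B ℤ.* A  ≡⟨ swap c B A ⟩
  c ℤ.* A ℤ.* B  ∎)
  where
  open ℤ.≤-Reasoning
  swap : ∀ x y z → x ℤ.* y ℤ.* z ≡ x ℤ.* z ℤ.* y
  swap = xy∙z≈xz∙y ℤ.*-commutativeSemigroup

positive⇒nonNegative : ∀ {i} → Positive i → NonNegative i
positive⇒nonNegative {+[1+ _ ]} _ = _

pronic-positive : ∀ {d} → 1ℤ ℤ.≤ d → Positive (d ℤ.* (d ℤ.+ 1ℤ))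
pronic-positive {+[1+ _ ]} _ = _
pronic-positive {+ zero}   (+≤+ ())

if-∸-≤ : ∀ {k m} b c → k ≤ toℕ b + m → toℕ b ≤ toℕ c → (if c then k ∸ 1 else k) ≤ m
if-∸-≤ {k} {m} b true  k≤b+m b≤c = ℕ.m≤n+o⇒m∸n≤o k 1 (ℕ.≤-trans k≤b+m (ℕ.+-monoˡ-≤ m b≤c))
if-∸-≤         false false k≤m _  = k≤m
if-∸-≤         true  false _   ()

if-pred-≡ : ∀ {d m} c → d ≡ + (toℕ c + m) → (if c then d ℤ.- 1ℤ else d) ≡ + m
if-pred-≡ false refl = refl
if-pred-≡ true  refl = refl

module MTS {n : ℕ} (E : Digraph n) where

  liveIn : Subset′ n → Subset′ n → Fin n → Subset′ n
  liveIn X Y u w = E w u ∧ X w ∧ not (Y w)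

  rankedIn : (Fin n → ℕ) → Subset′ n → Subset′ n → Fin n → Subset′ n
  rankedIn r X Y u w = E w u ∧ X w ∧ (not (Y w) ∨ does (r u <? r w))

  -- rank records the order in which nodes entered L.
  record Invariant (s : State n) : Set where
    field
      δ-live     : ∀ {u} → U s u ≡ true → δ s u ≡ + count (liveIn (U s) (L s) u)
      rank       : Fin n → ℕ
      fresh      : ℕ
      rank<fresh : ∀ w → rank w < fresh
      k-ranked   : ∀ {u} → U s u ≡ true → L s u ≡ true → k s u ≤ count (rankedIn rank (U s) (L s) u)

  initial : ∀ t → Invariant (initState E t)
  initial t = record
    { δ-live     = λ {u} _ → cong +_ (trans (sym (count≡sum (λ w → E w u)))
                                           (count-cong λ w → sym (Bool.∧-identityʳ (E w u))))
    ; rank       = λ _ → 0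
    ; fresh      = 1
    ; rank<fresh = λ _ → s≤s z≤n
    ; k-ranked   = λ _ ()
    }

  module _ {s : State n} (I : Invariant s) {v : Fin n} (Uv : U s v ≡ true) where
    open Invariant I

    private
      U′ : Subset′ n
      U′ = update (U s) v false

    δ-after-removal : ∀ {u} c → U′ u ≡ true → c ≡ E v u ∧ not (L s v) →
                      (if c then δ s u ℤ.- 1ℤ else δ s u) ≡ + count (liveIn U′ (L s) u)
    δ-after-removal {u} c U′u refl =
      if-pred-≡ c (trans (δ-live (update-false⇒true (U s) U′u))
                         (cong +_ (count-∧-removed (U s) (λ w → E w u) (not ∘ L s) Uv)))

    removal-preserves : ∀ S′ δ′ → (∀ {u} → U′ u ≡ true → δ′ u ≡ + count (liveIn U′ (L s) u)) →
      Invariant (st S′ U′ (L s) (λ u → if E v u ∧ U s u then k s u ∸ 1 else k s u) δ′)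
    removal-preserves S′ δ′ δ′-live = record
      { δ-live     = δ′-live
      ; rank       = rank
      ; fresh      = fresh
      ; rank<fresh = rank<fresh
      ; k-ranked   = k-after
      }
      where
      k-after : ∀ {u} → U′ u ≡ true → L s u ≡ true →
                (if E v u ∧ U s u then k s u ∸ 1 else k s u) ≤ count (rankedIn rank U′ (L s) u)
      k-after {u} U′u Lu = if-∸-≤ (E v u ∧ φ v) (E v u ∧ U s u)
          (subst (k s u ≤_) (count-∧-removed (U s) (λ w → E w u) φ Uv) (k-ranked Uu Lu))
          (subst (λ x → toℕ (E v u ∧ φ v) ≤ toℕ (E v u ∧ x)) (sym Uu)
                 (toℕ-∧-monoʳ (E v u) (toℕ≤1 (φ v))))
        where
        Uu : U s u ≡ true
        Uu = update-false⇒true (U s) U′u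
        φ : Fin n → Bool
        φ w = not (L s w) ∨ does (rank u <? rank w)

  marking-preserves : (∀ w → E w w ≡ false) → ∀ {s} → Invariant s →
    ∀ {v} → U s v ≡ true → L s v ≡ false → ¬ (δ s v ℤ.< + k s v) →
    Invariant (st (S s) (U s) (update (L s) v true) (k s) (λ u → if E v u ∧ U s u then δ s u ℤ.- 1ℤ else δ s u))
  marking-preserves noloop {s} I {v} Uv Lv δv≮kv = record
    { δ-live     = δ-after
    ; rank       = rank′
    ; fresh      = suc fresh
    ; rank<fresh = rank′<fresh
    ; k-ranked   = λ {u} → k-after (u ≟ v)
    }
    where
    open Invariant I
    L′ : Subset′ n
    L′ = update (L s) v true
    rank′ : Fin n → ℕ
    rank′ = update rank v fresh

    rank′<fresh : ∀ w → rank′ w < suc fresh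
    rank′<fresh w with w ≟ v
    ... | yes _ = ℕ.n<1+n fresh
    ... | no  _ = ℕ.m<n⇒m<1+n (rank<fresh w)

    δ-after : ∀ {u} → U s u ≡ true →
              (if E v u ∧ U s u then δ s u ℤ.- 1ℤ else δ s u) ≡ + count (liveIn (U s) L′ u)
    δ-after {u} Uu = if-pred-≡ (E v u ∧ U s u) (trans (δ-live Uu) (cong +_ live-split))
      where
      marked-not-live : E v u ∧ U s v ∧ false ≡ false
      marked-not-live = trans (cong (λ x → E v u ∧ x ∧ false) Uv) (Bool.∧-zeroʳ (E v u))
      was-live : E v u ∧ U s v ∧ not (L s v) ≡ E v u ∧ U s u
      was-live = trans (cong₂ (λ x y → E v u ∧ x ∧ not y) Uv Lv) (sym (cong (E v u ∧_) Uu))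
      live-split : count (liveIn (U s) (L s) u) ≡ toℕ (E v u ∧ U s u) + count (liveIn (U s) L′ u)
      live-split = trans (count-update (L s) v true (λ w y → E w u ∧ U s w ∧ not y) marked-not-live)
                         (cong (λ b → toℕ b + count (liveIn (U s) L′ u)) was-live)

    kv≤live : k s v ≤ count (liveIn (U s) (L s) v)
    kv≤live = ℤ.drop‿+≤+ (subst (+ k s v ℤ.≤_) (δ-live Uv) (ℤ.≮⇒≥ δv≮kv))

    live⇒ranked : ∀ w → liveIn (U s) (L s) v w ≡ true → rankedIn rank′ (U s) L′ v w ≡ true
    live⇒ranked w = ∧-∧-monoʳ (E w v) (U s w) λ Ewv notLw →
      trans (cong (λ y → not y ∨ does (rank′ v <? rank′ w)) (update-≢ (L s) true (edge⇒≢ Ewv)))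
            (cong (_∨ does (rank′ v <? rank′ w)) notLw)
      where
      edge⇒≢ : E w v ≡ true → w ≢ v
      edge⇒≢ Ewv refl with () ← trans (sym Ewv) (noloop v)

    k-after : ∀ {u} → Dec (u ≡ v) → U s u ≡ true → L′ u ≡ true →
              k s u ≤ count (rankedIn rank′ (U s) L′ u)
    k-after (yes refl) _ _ = ℕ.≤-trans kv≤live (count-mono live⇒ranked)
    k-after {u} (no u≢v) Uu L′u =
      ℕ.≤-trans (k-ranked Uu (trans (sym (update-≢ (L s) true u≢v)) L′u))
                (count-mono λ w → ranked⇒ranked′ (w ≟ v))
      where
      ranked⇒ranked′ : ∀ {w} → Dec (w ≡ v) →
                       rankedIn rank (U s) (L s) u w ≡ true → rankedIn rank′ (U s) L′ u w ≡ true
      ranked⇒ranked′ (yes refl) = ∧-∧-monoʳ (E v u) (U s v) λ _ _ →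
        trans (cong (not (L′ v) ∨_) (dec-true (rank′ u <? rank′ v) rank′u<rank′v)) (Bool.∨-zeroʳ (not (L′ v)))
        where
        rank′u<rank′v : rank′ u < rank′ v
        rank′u<rank′v = subst₂ _<_ (sym (update-≢ rank fresh u≢v)) (sym (update-≡ rank v fresh)) (rank<fresh u)
      ranked⇒ranked′ {w} (no w≢v)
        rewrite update-≢ (L s) true w≢v | update-≢ rank fresh w≢v | update-≢ rank fresh u≢v = id

  step-preserves : (∀ w → E w w ≡ false) → ∀ {s s′} → Step E s s′ → Invariant s → Invariant s′
  step-preserves _ {s} (case1 v Uv _) I = removal-preserves I Uv (S s) _ λ {u} U′u →
    δ-after-removal I Uv (E v u ∧ U s u ∧ not (L s v)) U′u
      (cong (λ x → E v u ∧ x ∧ not (L s v)) (update-false⇒true (U s) U′u))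
  step-preserves _ {s} (case2 _ v Uv Lv _) I = removal-preserves I Uv (update (S s) v true) _ λ {u} U′u →
    δ-after-removal I Uv (E v u ∧ U s u) U′u
      (cong (E v u ∧_) (trans (update-false⇒true (U s) U′u) (cong not (sym Lv))))
  step-preserves noloop (case3 _ δ≮k v Uv Lv _) I = marking-preserves noloop I Uv Lv (δ≮k v Uv Lv)

  run-preserves : (∀ w → E w w ≡ false) → ∀ {m s s′} → Run E m s s′ → Invariant s → Invariant s′
  run-preserves noloop done            = id
  run-preserves noloop (next step run) = run-preserves noloop run ∘ step-preserves noloop step

  ∃-zero-threshold : ∀ {s} → Invariant s → (∀ u → U s u ≡ true → L s u ≡ true) →
                     ∃ (λ u → U s u ≡ true) → ∃ λ u → U s u ≡ true × k s u ≡ 0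
  ∃-zero-threshold {s} I U⊆L ∃u =
    zero-at (∃-greatest (λ x y → rank x ≤ rank y) (λ u → U s u Bool.≟ true)
                        (λ _ _ → ℕ.≤-total _ _) (λ _ _ _ → ℕ.≤-trans) ∃u)
    where
    open Invariant I
    zero-at : (∃ λ m → U s m ≡ true × (∀ {w} → U s w ≡ true → rank w ≤ rank m)) →
              ∃ λ u → U s u ≡ true × k s u ≡ 0
    zero-at (m , Um , latest) =
      m , Um , ℕ.n≤0⇒n≡0 (subst (k s m ≤_) (count-false none-ranked) (k-ranked Um (U⊆L m Um)))
      where
      none-ranked : ∀ w → rankedIn rank (U s) (L s) m w ≡ false
      none-ranked w with U s w in Uw
      ... | false = Bool.∧-zeroʳ (E w m)
      ... | true rewrite U⊆L w Uw | dec-false (rank m <? rank w) (ℕ.≤⇒≯ (latest Uw)) = Bool.∧-zeroʳ (E w m)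

  module _ {s : State n} (k≢0 : ∀ u → U s u ≡ true → ¬ (k s u ≡ 0))
           (δ≮k : ∀ u → U s u ≡ true → L s u ≡ false → ¬ (δ s u ℤ.< + k s u)) where

    Active : Fin n → Set
    Active u = U s u ≡ true × L s u ≡ false

    pronic-δ : Fin n → ℤ
    pronic-δ u = δ s u ℤ.* (δ s u ℤ.+ 1ℤ)

    ratio-≤ : Rel (Fin n) _
    ratio-≤ x y = + k s x ℤ.* pronic-δ y ℤ.≤ + k s y ℤ.* pronic-δ x

    pronic-δ-positive : ∀ {u} → Active u → Positive (pronic-δ u)
    pronic-δ-positive {u} (Uu , Lu) =
      pronic-positive (ℤ.≤-trans (+≤+ (ℕ.n≢0⇒n>0 (k≢0 u Uu))) (ℤ.≮⇒≥ (δ≮k u Uu Lu)))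

    ratio-≤-trans : ∀ {x y z} → Active x → Active y → Active z → ratio-≤ x y → ratio-≤ y z → ratio-≤ x z
    ratio-≤-trans {x} {y} {z} ax ay az =
      *-cross-≤-trans {+ k s x} {+ k s y} {+ k s z} {pronic-δ x} {pronic-δ y} {pronic-δ z}
        {{positive⇒nonNegative (pronic-δ-positive ax)}} {{pronic-δ-positive ay}}
        {{positive⇒nonNegative (pronic-δ-positive az)}}

    mark-step : ∃ Active → ∃ (Step E s)
    mark-step ∃active
      with ∃-greatest ratio-≤ (λ u → U s u Bool.≟ true ×-dec L s u Bool.≟ false) (λ _ _ → ℤ.≤-total _ _)
                      ratio-≤-trans ∃active
    ... | v , (Uv , Lv) , greatest = -, case3 k≢0 δ≮k v Uv Lv (λ u Uu Lu → greatest (Uu , Lu))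

  progress : ∀ {s} → Invariant s → ∃ (λ u → U s u ≡ true) → ∃ (Step E s)
  progress {s} I ∃u with Fin.any? (λ u → U s u Bool.≟ true ×-dec k s u ℕ.≟ 0)
  ... | yes (v , Uv , kv≡0) = -, case1 v Uv kv≡0
  ... | no ¬case1 with Fin.any? (λ u → U s u Bool.≟ true ×-dec L s u Bool.≟ false ×-dec δ s u ℤ.<? + k s u)
  ...   | yes (v , Uv , Lv , δv<kv) = -, case2 (λ u Uu k≡0 → ¬case1 (u , Uu , k≡0)) v Uv Lv δv<kv
  ...   | no ¬case2 with Fin.any? (λ u → U s u Bool.≟ true ×-dec L s u Bool.≟ false)
  ...     | yes ∃active = mark-step (λ u Uu k≡0 → ¬case1 (u , Uu , k≡0))
                                    (λ u Uu Lu δ<k → ¬case2 (u , Uu , Lu , δ<k)) ∃active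
  ...     | no ¬active =
    ⊥-elim (¬case1 (∃-zero-threshold I (λ u Uu → Bool.¬-not λ Lu → ¬active (u , Uu , Lu)) ∃u))

  pending : State n → ℕ
  pending s = count (U s) + count (not ∘ L s)

  step-pending : ∀ {s s′} → Step E s s′ → pending s ≡ suc (pending s′)
  step-pending {s} (case1 v Uv _)       = cong (_+ count (not ∘ L s)) (count-removed (U s) Uv)
  step-pending {s} (case2 _ v Uv _ _)   = cong (_+ count (not ∘ L s)) (count-removed (U s) Uv)
  step-pending {s} (case3 _ _ v _ Lv _) =
    trans (cong (λ c → count (U s) + c) (count-not-marked (L s) Lv)) (ℕ.+-suc (count (U s)) _)

  run-pending : ∀ {m s s′} → Run E m s s′ → pending s ≡ m + pending s′
  run-pending done            = refl
  run-pending (next step run) = trans (step-pending step) (cong suc (run-pending run))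

  pending-initial : ∀ t → pending (initState E t) ≡ 2 * n
  pending-initial t = trans (cong₂ _+_ (count-true n) (count-true n)) (cong (λ c → n + c) (sym (ℕ.+-identityʳ n)))

lemma1 : (n : ℕ) (E : Digraph n) → (∀ v → E v v ≡ false) → (t : Fin n → ℕ) →
    (∀ m s → Run E m (initState E t) s → ∃ (λ u → U s u ≡ true) → ∃ (λ s′ → Step E s s′))
    × (∀ m s → Run E m (initState E t) s → m ≤ 2 * n)
lemma1 n E noloop t =
  (λ m s run → progress (run-preserves noloop run (initial t))) ,
  (λ m s run → begin
    m                        ≤⟨ ℕ.m≤m+n m (pending s) ⟩
    m + pending s            ≡⟨ run-pending run ⟨
    pending (initState E t)  ≡⟨ pending-initial t ⟩
    2 * n                    ∎)
  where
  open MTS E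
  open ℕ.≤-Reasoning
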